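{- Let $M=\begin{bmatrix}1&1\\1&0\end{bmatrix}$ over $Z_3$ and let $G=Z_{40}\times Z_3\times Z_3$ with multiplication $[c,d,e][f,g,h]=[c+f \bmod 40,\; [d,e]M^{f}+[g,h] \bmod 3]$ (a group of order $360$). Let $S=\{g,g^{ -1}: g\in\{[39,1,2],[14,2,0],[32,0,2]\}\}$. Then $S$ consists of exactly $6$ non-identity elements and the Cayley graph $\mathrm{Cay}(G,S)$ is a connected $6$-regular graph of diameter $4$ on $360$ vertices.
   Context: For a finite group $G$ and an inverse-closed subset $S\subseteq G$ not containing the identity, the Cayley graph $\mathrm{Cay}(G,S)$ is the undirected graph with vertex set $G$ in which $x$ and $y$ are adjacent iff $y=xs$ for some $s\in S$; it is $|S|$-regular. The diameter of a connected graph is the maximum over all pairs of vertices of the length of a shortest path between them. Here $[d,e]M^f$ denotes the row vector $[d,e]$ multiplied by the $f$-th power of the matrix $M$, computed modulo $3$; the multiplicative order of $M$ divides $40$, so this is a semidirect product of $Z_{40}$ with $Z_3\times Z_3$. -}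

module Defs where

open import Data.Nat using (ℕ; zero; suc; _+_; _≤_)
open import Data.Nat.DivMod using (_mod_)
open import Data.Fin using (Fin; toℕ)
open import Data.Product using (_×_; _,_; ∃; Σ)
open import Data.List using (List; []; _∷_; concatMap)
open import Data.List.Membership.Propositional using (_∈_)
open import Relation.Binary.PropositionalEquality using (_≡_)

_⊕₄₀_ : Fin 40 → Fin 40 → Fin 40
a ⊕₄₀ b = (toℕ a + toℕ b) mod 40

neg₄₀ : Fin 40 → Fin 40
neg₄₀ a = (40 Data.Nat.∸ toℕ a) mod 40

_⊕₃_ : Fin 3 → Fin 3 → Fin 3
a ⊕₃ b = (toℕ a + toℕ b) mod 3

neg₃ : Fin 3 → Fin 3
neg₃ a = (3 Data.Nat.∸ toℕ a) mod 3

V : Set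
V = Fin 3 × Fin 3

_⊕V_ : V → V → V
(d , e) ⊕V (g , h) = (d ⊕₃ g , e ⊕₃ h)

negV : V → V
negV (d , e) = (neg₃ d , neg₃ e)

-- [d,e] M  with  M = [[1,1],[1,0]] over Z_3 :  [d,e] M = [d+e, d]
mulM : V → V
mulM (d , e) = (d ⊕₃ e , d)

mulMpow : V → ℕ → V
mulMpow v zero = v
mulMpow v (suc k) = mulMpow (mulM v) k

G : Set
G = Fin 40 × V

_·_ : G → G → G
(c , v) · (f , w) = (c ⊕₄₀ f , mulMpow v (toℕ f) ⊕V w)

e : G
e = (0 mod 40 , (0 mod 3 , 0 mod 3))

-- inverse: [c,v]^{-1} = [-c, -(v M^{-c})]   (M^40 = I)
inv : G → G
inv (c , v) = (neg₄₀ c , negV (mulMpow v (toℕ (neg₄₀ c))))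

mk : ℕ → ℕ → ℕ → G
mk c d e' = (c mod 40 , (d mod 3 , e' mod 3))

generators : List G
generators = mk 39 1 2 ∷ mk 14 2 0 ∷ mk 32 0 2 ∷ []

-- S = { g, g^{-1} : g ∈ generators }, listed as g₁, g₁⁻¹, g₂, g₂⁻¹, g₃, g₃⁻¹
S : List G
S = concatMap (λ g → g ∷ inv g ∷ []) generators

Adj : G → G → Set
Adj x y = ∃ λ s → s ∈ S × y ≡ x · s

data Walk : ℕ → G → G → Set where
  nil  : ∀ {x} → Walk 0 x x
  step : ∀ {k x y z} → Adj x y → Walk k y z → Walk (suc k) x z

DistLe : ℕ → G → G → Set
DistLe n x y = ∃ λ k → k ≤ n × Walk k x y

Connected : Set
Connected = ∀ x y → ∃ λ k → Walk k x y

Diameter : ℕ → Set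
Diameter d = (∀ x y → DistLe d x y) × (∃ λ x → ∃ λ y → ∀ k → Walk k x y → d ≤ k)

{-# OPTIONS --safe #-}

-- M acts on row vectors by the Fibonacci recurrence [d,e] ↦ [d+e,d], whose period modulo 3 is 8.
-- As 8 divides 40, [d,e]M^f depends only on f mod 40, which makes the multiplication associative;
-- the remaining group laws are finitely many identities, checked on all 360 elements. Left
-- multiplication carries walks to walks, so every distance is a distance from e: a table of words
-- of length at most 4 reaching each element bounds the diameter by 4, and exhaustive search of the
-- walks of length below 4 shows that [0,0,1] is at distance exactly 4.
module Submission where

open import Defs
open import Level using (0ℓ)
open import Data.Nat using (ℕ; zero; suc; _+_; _*_; _∸_; _≤_; _≤?_; NonZero; _%_; _/_)
open import Data.Nat.Properties using (+-assoc; +-comm; *-assoc; m≤m+n)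
open import Data.Nat.DivMod using (_mod_; %-distribˡ-+; m%n%n≡m%n; m≡m%n+[m/n]*n)
open import Data.Digit using (toNatDigits)
open import Data.Fin using (Fin; toℕ) renaming (_≟_ to _≟F_)
open import Data.Fin.Properties using (toℕ-injective; toℕ-fromℕ<; *↔×)
open import Data.Product using (_×_; Σ; _,_; ∃)
open import Data.Product.Properties using (≡-dec)
open import Data.Product.Function.NonDependent.Propositional using (_×-↔_)
open import Data.List using (List; []; _∷_; length; map; foldl; lookup; allFin; cartesianProduct)
open import Data.List.Membership.Propositional using (_∈_; find; lose)
open import Data.List.Membership.Propositional.Properties using (∈-map⁺; ∈-map⁻; ∈-allFin; ∈-cartesianProduct⁺; ∈-lookup)
open import Data.List.Relation.Unary.All as All using (All; all?)
open import Data.List.Relation.Unary.Any using (Any; here; there; any?)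
open import Data.List.Relation.Unary.Unique.Propositional using (Unique)
open import Data.List.Relation.Unary.Unique.Propositional.Properties using (map⁺)
open import Data.List.Relation.Unary.Unique.DecPropositional using (unique?)
open import Data.List.Relation.Binary.Pointwise using (Pointwise; _∷_)
open import Data.List.Relation.Binary.Pointwise.Properties using (decidable)
open import Data.Empty using (⊥-elim)
open import Relation.Nullary using (Dec; yes; no; ¬?; _×-dec_)
open import Relation.Nullary.Decidable using (True; toWitness; toWitnessFalse; map′)
open import Relation.Unary using (Pred; Decidable)
open import Relation.Binary.Definitions using (DecidableEquality)
open import Relation.Binary.PropositionalEquality using (_≡_; _≢_; refl; sym; cong; cong₂; subst; subst₂; module ≡-Reasoning)
open import Function.Base using (_∘_)
open import Function.Bundles using (_↔_; _⇔_; mk⇔)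
open import Function.Properties.Inverse using (↔-sym; ↔-trans; ↔-refl)

open ≡-Reasoning

addMod : ∀ n .{{_ : NonZero n}} → Fin n → Fin n → Fin n
addMod n a b = (toℕ a + toℕ b) mod n

toℕ-mod : ∀ m n .{{_ : NonZero n}} → toℕ (m mod n) ≡ m % n
toℕ-mod m n = toℕ-fromℕ< _

[m%n+k]%n≡[m+k]%n : ∀ m k n .{{_ : NonZero n}} → (m % n + k) % n ≡ (m + k) % n
[m%n+k]%n≡[m+k]%n m k n = begin
  (m % n + k) % n          ≡⟨ %-distribˡ-+ (m % n) k n ⟩
  (m % n % n + k % n) % n  ≡⟨ cong (λ r → (r + k % n) % n) (m%n%n≡m%n m n) ⟩
  (m % n + k % n) % n      ≡⟨ %-distribˡ-+ m k n ⟨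
  (m + k) % n              ∎

[m+k%n]%n≡[m+k]%n : ∀ m k n .{{_ : NonZero n}} → (m + k % n) % n ≡ (m + k) % n
[m+k%n]%n≡[m+k]%n m k n = begin
  (m + k % n) % n  ≡⟨ cong (_% n) (+-comm m (k % n)) ⟩
  (k % n + m) % n  ≡⟨ [m%n+k]%n≡[m+k]%n k m n ⟩
  (k + m) % n      ≡⟨ cong (_% n) (+-comm k m) ⟩
  (m + k) % n      ∎

addMod-assoc : ∀ n .{{_ : NonZero n}} (a b c : Fin n) →
               addMod n (addMod n a b) c ≡ addMod n a (addMod n b c)
addMod-assoc n a b c = toℕ-injective (begin
  toℕ (addMod n (addMod n a b) c)  ≡⟨ toℕ-mod (toℕ (addMod n a b) + C) n ⟩
  (toℕ (addMod n a b) + C) % n     ≡⟨ cong (λ r → (r + C) % n) (toℕ-mod (A + B) n) ⟩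
  ((A + B) % n + C) % n            ≡⟨ [m%n+k]%n≡[m+k]%n (A + B) C n ⟩
  (A + B + C) % n                  ≡⟨ cong (_% n) (+-assoc A B C) ⟩
  (A + (B + C)) % n                ≡⟨ [m+k%n]%n≡[m+k]%n A (B + C) n ⟨
  (A + (B + C) % n) % n            ≡⟨ cong (λ r → (A + r) % n) (toℕ-mod (B + C) n) ⟨
  (A + toℕ (addMod n b c)) % n     ≡⟨ toℕ-mod (A + toℕ (addMod n b c)) n ⟨
  toℕ (addMod n a (addMod n b c))  ∎)
  where
  A = toℕ a
  B = toℕ b
  C = toℕ c

addMod-comm : ∀ n .{{_ : NonZero n}} (a b : Fin n) → addMod n a b ≡ addMod n b a
addMod-comm n a b = cong (_mod n) (+-comm (toℕ a) (toℕ b))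

⊕₃-interchange : ∀ a b c d → (a ⊕₃ b) ⊕₃ (c ⊕₃ d) ≡ (a ⊕₃ c) ⊕₃ (b ⊕₃ d)
⊕₃-interchange a b c d = begin
  (a ⊕₃ b) ⊕₃ (c ⊕₃ d)  ≡⟨ addMod-assoc 3 a b (c ⊕₃ d) ⟩
  a ⊕₃ (b ⊕₃ (c ⊕₃ d))  ≡⟨ cong (a ⊕₃_) (addMod-assoc 3 b c d) ⟨
  a ⊕₃ ((b ⊕₃ c) ⊕₃ d)  ≡⟨ cong (λ r → a ⊕₃ (r ⊕₃ d)) (addMod-comm 3 b c) ⟩
  a ⊕₃ ((c ⊕₃ b) ⊕₃ d)  ≡⟨ cong (a ⊕₃_) (addMod-assoc 3 c b d) ⟩
  a ⊕₃ (c ⊕₃ (b ⊕₃ d))  ≡⟨ addMod-assoc 3 a c (b ⊕₃ d) ⟨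
  (a ⊕₃ c) ⊕₃ (b ⊕₃ d)  ∎

⊕V-assoc : ∀ u v w → (u ⊕V v) ⊕V w ≡ u ⊕V (v ⊕V w)
⊕V-assoc (a , b) (c , d) (f , g) = cong₂ _,_ (addMod-assoc 3 a c f) (addMod-assoc 3 b d g)

mulM-⊕V : ∀ u v → mulM (u ⊕V v) ≡ mulM u ⊕V mulM v
mulM-⊕V (a , b) (c , d) = cong (_, (a ⊕₃ c)) (⊕₃-interchange a c b d)

mulMpow-⊕V : ∀ u v k → mulMpow (u ⊕V v) k ≡ mulMpow u k ⊕V mulMpow v k
mulMpow-⊕V u v zero    = refl
mulMpow-⊕V u v (suc k) = begin
  mulMpow (mulM (u ⊕V v)) k                ≡⟨ cong (λ w → mulMpow w k) (mulM-⊕V u v) ⟩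
  mulMpow (mulM u ⊕V mulM v) k             ≡⟨ mulMpow-⊕V (mulM u) (mulM v) k ⟩
  mulMpow (mulM u) k ⊕V mulMpow (mulM v) k ∎

mulMpow-+ : ∀ v m n → mulMpow v (m + n) ≡ mulMpow (mulMpow v m) n
mulMpow-+ v zero    n = refl
mulMpow-+ v (suc m) n = mulMpow-+ (mulM v) m n

byExhaustion : {A : Set} {P : Pred A 0ℓ} {xs : List A} → (∀ x → x ∈ xs) →
               (P? : Decidable P) → {True (all? P? xs)} → ∀ x → P x
byExhaustion complete P? {ok} x = All.lookup (toWitness ok) (complete x)

infix 4 _≟V_ _≟G_

_≟V_ : DecidableEquality V
_≟V_ = ≡-dec _≟F_ _≟F_

_≟G_ : DecidableEquality G
_≟G_ = ≡-dec _≟F_ _≟V_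

allV : List V
allV = cartesianProduct (allFin 3) (allFin 3)

allG : List G
allG = cartesianProduct (allFin 40) allV

∈-allV : ∀ v → v ∈ allV
∈-allV (d , f) = ∈-cartesianProduct⁺ (∈-allFin d) (∈-allFin f)

∈-allG : ∀ x → x ∈ allG
∈-allG (c , v) = ∈-cartesianProduct⁺ (∈-allFin c) (∈-allV v)

mulMpow-8 : ∀ v → mulMpow v 8 ≡ v
mulMpow-8 = byExhaustion ∈-allV (λ v → mulMpow v 8 ≟V v)

mulMpow-*8 : ∀ v q → mulMpow v (q * 8) ≡ v
mulMpow-*8 v zero    = refl
mulMpow-*8 v (suc q) = begin
  mulMpow v (8 + q * 8)            ≡⟨ mulMpow-+ v 8 (q * 8) ⟩
  mulMpow (mulMpow v 8) (q * 8)    ≡⟨ cong (λ w → mulMpow w (q * 8)) (mulMpow-8 v) ⟩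
  mulMpow v (q * 8)                ≡⟨ mulMpow-*8 v q ⟩
  v                                ∎

mulMpow-%40 : ∀ v n → mulMpow v (n % 40) ≡ mulMpow v n
mulMpow-%40 v n = sym (begin
  mulMpow v n                                  ≡⟨ cong (mulMpow v) (m≡m%n+[m/n]*n n 40) ⟩
  mulMpow v (n % 40 + n / 40 * 40)             ≡⟨ mulMpow-+ v (n % 40) (n / 40 * 40) ⟩
  mulMpow (mulMpow v (n % 40)) (n / 40 * 40)   ≡⟨ cong (mulMpow _) (*-assoc (n / 40) 5 8) ⟨
  mulMpow (mulMpow v (n % 40)) (n / 40 * 5 * 8) ≡⟨ mulMpow-*8 _ (n / 40 * 5) ⟩
  mulMpow v (n % 40)                           ∎)

·-assoc : ∀ x y z → (x · y) · z ≡ x · (y · z)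
·-assoc (c , u) (f , v) (g , w) = cong₂ _,_ (addMod-assoc 40 c f g) (begin
  mulMpow (u′ ⊕V v) j ⊕V w                ≡⟨ cong (_⊕V w) (mulMpow-⊕V u′ v j) ⟩
  (mulMpow u′ j ⊕V mulMpow v j) ⊕V w       ≡⟨ ⊕V-assoc (mulMpow u′ j) (mulMpow v j) w ⟩
  mulMpow u′ j ⊕V (mulMpow v j ⊕V w)       ≡⟨ cong (_⊕V (mulMpow v j ⊕V w)) exponent ⟩
  mulMpow u (toℕ (f ⊕₄₀ g)) ⊕V (mulMpow v j ⊕V w)  ∎)
  where
  i = toℕ f
  j = toℕ g
  u′ = mulMpow u i
  exponent : mulMpow u′ j ≡ mulMpow u (toℕ (f ⊕₄₀ g))
  exponent = begin
    mulMpow (mulMpow u i) j    ≡⟨ mulMpow-+ u i j ⟨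
    mulMpow u (i + j)          ≡⟨ mulMpow-%40 u (i + j) ⟨
    mulMpow u ((i + j) % 40)   ≡⟨ cong (mulMpow u) (toℕ-mod (i + j) 40) ⟨
    mulMpow u (toℕ (f ⊕₄₀ g))  ∎

·-identityˡ : ∀ x → e · x ≡ x
·-identityˡ = byExhaustion ∈-allG (λ x → e · x ≟G x)

·-identityʳ : ∀ x → x · e ≡ x
·-identityʳ = byExhaustion ∈-allG (λ x → x · e ≟G x)

·-inverseˡ : ∀ x → inv x · x ≡ e
·-inverseˡ = byExhaustion ∈-allG (λ x → inv x · x ≟G e)

·-inverseʳ : ∀ x → x · inv x ≡ e
·-inverseʳ = byExhaustion ∈-allG (λ x → x · inv x ≟G e)

·-cancelˡ : ∀ x {y z} → x · y ≡ x · z → y ≡ z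
·-cancelˡ x {y} {z} xy≡xz = begin
  y                ≡⟨ ·-identityˡ y ⟨
  e · y            ≡⟨ cong (_· y) (·-inverseˡ x) ⟨
  (inv x · x) · y  ≡⟨ ·-assoc (inv x) x y ⟩
  inv x · (x · y)  ≡⟨ cong (inv x ·_) xy≡xz ⟩
  inv x · (x · z)  ≡⟨ ·-assoc (inv x) x z ⟨
  (inv x · x) · z  ≡⟨ cong (_· z) (·-inverseˡ x) ⟩
  e · z            ≡⟨ ·-identityˡ z ⟩
  z                ∎

x·[x⁻¹·y]≡y : ∀ x y → x · (inv x · y) ≡ y
x·[x⁻¹·y]≡y x y = begin
  x · (inv x · y)  ≡⟨ ·-assoc x (inv x) y ⟨
  (x · inv x) · y  ≡⟨ cong (_· y) (·-inverseʳ x) ⟩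
  e · y            ≡⟨ ·-identityˡ y ⟩
  y                ∎

Adj⇔∈neighbours : ∀ x y → Adj x y ⇔ (y ∈ map (x ·_) S)
Adj⇔∈neighbours x y = mk⇔ (λ { (s , s∈S , refl) → ∈-map⁺ (x ·_) s∈S }) (∈-map⁻ (x ·_))

translateWalk : ∀ x {k y z} → Walk k y z → Walk k (x · y) (x · z)
translateWalk x nil = nil
translateWalk x {y = y} (step (s , s∈S , refl) walk) =
  step (s , s∈S , sym (·-assoc x y s)) (translateWalk x walk)

walk? : ∀ k x y → Dec (Walk k x y)
walk? zero x y with x ≟G y
... | yes refl = yes nil
... | no x≢y   = no λ { nil → x≢y refl }
walk? (suc k) x z = map′ fromAny toAny (any? (λ s → walk? k (x · s) z) S)
  where
  fromAny : Any (λ s → Walk k (x · s) z) S → Walk (suc k) x z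
  fromAny found with find found
  ... | s , s∈S , walk = step (s , s∈S , refl) walk
  toAny : Walk (suc k) x z → Any (λ s → Walk k (x · s) z) S
  toAny (step (s , s∈S , refl) walk) = lose s∈S walk

-- A numeral spells the word of its decimal digits, digit d (1 ≤ d ≤ 6) standing for the d-th
-- element of S; 0 spells the empty word.
letterIndex : ℕ → Fin (length S)
letterIndex d = (d ∸ 1) mod 6

letter : ℕ → G
letter d = lookup S (letterIndex d)

spell : ℕ → List ℕ
spell zero        = []
spell n@(suc _)   = toNatDigits 10 n

endpoint : G → List ℕ → G
endpoint = foldl (λ x d → x · letter d)

walkAlong : ∀ x ds → Walk (length ds) x (endpoint x ds)
walkAlong x []       = nil
walkAlong x (d ∷ ds) = step (letter d , ∈-lookup (letterIndex d) , refl) (walkAlong (x · letter d) ds)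

Spells : G → ℕ → Set
Spells x n = endpoint e (spell n) ≡ x × length (spell n) ≤ 4

-- Row c lists the words for [c,0,0], [c,0,1], …, [c,2,2], in the order of allG.
routes : List ℕ
routes =
     0 ∷ 4231 ∷ 2413 ∷ 1423 ∷ 2314 ∷ 1324 ∷ 3546 ∷ 1526 ∷ 2516 ∷
  1466 ∷ 1333 ∷    2 ∷ 1646 ∷  324 ∷  423 ∷  526 ∷ 6614 ∷ 3313 ∷
   646 ∷ 2324 ∷ 2423 ∷  664 ∷ 5455 ∷ 5226 ∷  466 ∷  333 ∷   22 ∷
  1544 ∷ 1445 ∷ 2664 ∷ 2333 ∷  222 ∷ 2466 ∷ 3233 ∷ 1454 ∷ 2646 ∷
   454 ∷ 1351 ∷ 6363 ∷  445 ∷ 1135 ∷  544 ∷ 1153 ∷ 3115 ∷ 1513 ∷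
  1161 ∷ 2454 ∷  351 ∷  315 ∷ 2445 ∷  135 ∷  513 ∷  153 ∷ 1116 ∷
  1352 ∷   53 ∷  116 ∷  161 ∷ 1523 ∷ 1325 ∷  611 ∷ 4446 ∷   35 ∷
   235 ∷ 1463 ∷ 4631 ∷   16 ∷  352 ∷  253 ∷  325 ∷   61 ∷  523 ∷
  2253 ∷    6 ∷ 2352 ∷  162 ∷  364 ∷  261 ∷ 3522 ∷ 2235 ∷  463 ∷
    26 ∷ 4263 ∷ 1455 ∷ 1622 ∷ 2261 ∷   62 ∷ 3642 ∷ 2463 ∷ 1545 ∷
   622 ∷ 6466 ∷  262 ∷ 1144 ∷ 1414 ∷  545 ∷  226 ∷ 4666 ∷  455 ∷
   414 ∷ 1131 ∷  144 ∷ 1311 ∷ 2455 ∷ 2226 ∷ 4525 ∷ 2262 ∷  441 ∷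
  3553 ∷ 1424 ∷ 4142 ∷  131 ∷   44 ∷  113 ∷ 5353 ∷ 3535 ∷  311 ∷
  1132 ∷ 1635 ∷  424 ∷   13 ∷   31 ∷  244 ∷  442 ∷ 4133 ∷ 1536 ∷
  1166 ∷ 4224 ∷  536 ∷  132 ∷  635 ∷ 2424 ∷    3 ∷  231 ∷ 1661 ∷
   661 ∷   23 ∷ 2231 ∷ 1322 ∷  166 ∷ 1555 ∷ 5236 ∷   32 ∷  616 ∷
   555 ∷  322 ∷   66 ∷ 2616 ∷ 1541 ∷  232 ∷ 1415 ∷ 1154 ∷  223 ∷
   145 ∷  266 ∷ 2555 ∷  541 ∷  451 ∷ 3222 ∷  154 ∷  514 ∷  415 ∷
  1524 ∷ 2451 ∷ 1452 ∷   54 ∷ 1425 ∷ 2415 ∷   45 ∷ 1542 ∷ 3544 ∷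
   425 ∷ 1335 ∷  254 ∷  542 ∷ 4164 ∷  245 ∷ 3135 ∷  452 ∷  524 ∷
  1631 ∷ 1163 ∷ 1613 ∷  335 ∷ 1316 ∷  446 ∷ 3116 ∷ 2245 ∷  353 ∷
   613 ∷  631 ∷  163 ∷ 2446 ∷  136 ∷  316 ∷  361 ∷ 3523 ∷ 3325 ∷
  2361 ∷ 3364 ∷ 1155 ∷ 1551 ∷ 1326 ∷   63 ∷ 1362 ∷   36 ∷ 1632 ∷
   632 ∷  362 ∷  236 ∷  155 ∷ 1114 ∷ 1666 ∷  263 ∷  551 ∷  326 ∷
   666 ∷   55 ∷  114 ∷ 1552 ∷  411 ∷ 2551 ∷ 2236 ∷  141 ∷ 1525 ∷
   255 ∷   14 ∷ 2666 ∷ 2411 ∷ 1645 ∷  552 ∷   41 ∷  525 ∷ 1142 ∷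
  1331 ∷  645 ∷ 1313 ∷  241 ∷  546 ∷  142 ∷ 2255 ∷    4 ∷ 3113 ∷
  1422 ∷   42 ∷  133 ∷   24 ∷ 4423 ∷ 6452 ∷ 2645 ∷  313 ∷  331 ∷
  2313 ∷ 2331 ∷ 1323 ∷  242 ∷   33 ∷  422 ∷ 3536 ∷ 6353 ∷  224 ∷
   323 ∷ 5111 ∷ 1511 ∷ 2422 ∷ 2242 ∷  233 ∷  332 ∷ 1663 ∷ 6163 ∷
   115 ∷  663 ∷ 3232 ∷  636 ∷ 5535 ∷  511 ∷ 3555 ∷ 3322 ∷  151 ∷
    51 ∷ 1354 ∷ 1152 ∷ 3514 ∷   15 ∷ 2663 ∷ 1453 ∷ 2636 ∷ 3145 ∷
  1146 ∷ 1641 ∷    5 ∷ 1164 ∷  453 ∷ 1614 ∷  152 ∷  251 ∷  354 ∷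
   641 ∷   25 ∷  146 ∷ 2453 ∷  614 ∷  164 ∷ 2251 ∷  416 ∷   52 ∷
  1642 ∷ 2614 ∷   64 ∷ 1426 ∷  522 ∷  252 ∷ 2641 ∷  225 ∷   46 ∷
  1336 ∷  624 ∷  426 ∷ 2225 ∷  246 ∷ 3631 ∷ 3316 ∷  264 ∷  642 ∷
   363 ∷ 2642 ∷ 4545 ∷  633 ∷ 2426 ∷  336 ∷ 1111 ∷ 6224 ∷ 4262 ∷
  3362 ∷ 2363 ∷ 1553 ∷ 1444 ∷ 1355 ∷ 3155 ∷ 1535 ∷  111 ∷ 3263 ∷
   535 ∷   11 ∷ 6636 ∷ 5116 ∷ 3141 ∷  553 ∷  444 ∷  355 ∷ 3114 ∷
  4424 ∷  516 ∷ 2355 ∷ 3525 ∷  413 ∷    1 ∷  314 ∷ 4442 ∷ 3255 ∷ []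

routes-spell : Pointwise Spells allG routes
routes-spell = toWitness {a? = decidable spells? allG routes} _
  where
  spells? : ∀ x n → Dec (Spells x n)
  spells? x n = endpoint e (spell n) ≟G x ×-dec length (spell n) ≤? 4

pointwise-∈ : {A B : Set} {R : A → B → Set} {xs : List A} {ys : List B} {x : A} →
              Pointwise R xs ys → x ∈ xs → ∃ λ y → R x y
pointwise-∈ (r ∷ _)  (here refl) = _ , r
pointwise-∈ (_ ∷ rs) (there x∈xs) = pointwise-∈ rs x∈xs

distance-from-e≤4 : ∀ y → DistLe 4 e y
distance-from-e≤4 y =
  let n , endpoint≡y , |n|≤4 = pointwise-∈ routes-spell (∈-allG y)
  in length (spell n) , |n|≤4 , subst (Walk _ e) endpoint≡y (walkAlong e (spell n))

distance≤4 : ∀ x y → DistLe 4 x y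
distance≤4 x y =
  let k , k≤4 , walk = distance-from-e≤4 (inv x · y)
  in k , k≤4 , subst₂ (Walk k) (·-identityʳ x) (x·[x⁻¹·y]≡y x y) (translateWalk x walk)

remote : G
remote = mk 0 0 1

distance-from-e-to-remote≥4 : ∀ k → Walk k e remote → 4 ≤ k
distance-from-e-to-remote≥4 0 = ⊥-elim ∘ toWitnessFalse {a? = walk? 0 e remote} _
distance-from-e-to-remote≥4 1 = ⊥-elim ∘ toWitnessFalse {a? = walk? 1 e remote} _
distance-from-e-to-remote≥4 2 = ⊥-elim ∘ toWitnessFalse {a? = walk? 2 e remote} _
distance-from-e-to-remote≥4 3 = ⊥-elim ∘ toWitnessFalse {a? = walk? 3 e remote} _
distance-from-e-to-remote≥4 (suc (suc (suc (suc k)))) _ = m≤m+n 4 k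

S-unique : Unique S
S-unique = toWitness {a? = unique? _≟G_ S} _

S-nonidentity : All (_≢ e) S
S-nonidentity = toWitness {a? = all? (λ s → ¬? (s ≟G e)) S} _

neighbours-unique : ∀ x → Unique (map (x ·_) S)
-- Without the explicit implicits, unification normalises x · s for a variable x, which blows up.
neighbours-unique x = map⁺ {f = x ·_} (·-cancelˡ x) {xs = S} S-unique

connected : Connected
connected x y = let k , _ , walk = distance≤4 x y in k , walk

G↔Fin360 : G ↔ Fin 360
G↔Fin360 = ↔-sym (↔-trans (*↔× {40} {9}) (↔-refl ×-↔ (*↔× {3} {3})))

mainTheorem11 : (Unique S × length S ≡ 6 × All (λ s → s ≢ e) S)
    × (G ↔ Fin 360)
    × (∀ x → Σ (List G) (λ N → Unique N × length N ≡ 6 × (∀ y → Adj x y ⇔ (y ∈ N))))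
    × Connected
    × Diameter 4
mainTheorem11 =
  (S-unique , refl , S-nonidentity) ,
  G↔Fin360 ,
  (λ x → map (x ·_) S , neighbours-unique x , refl , Adj⇔∈neighbours x) ,
  connected ,
  distance≤4 , e , remote , distance-from-e-to-remote≥4
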